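{- Let $G=(V,E)$ be a simple $2$-vertex-connected graph with at least five vertices, whose vertex set is partitioned into safe and unsafe vertices. Let $C$ be a $4$-cycle of $G$ with vertices $u,w,v,z$ in cyclic order (edges $uw,wv,vz,zu$) such that $\deg_G(w)=\deg_G(z)=2$ and $v$ is safe. Assume moreover that if $w$ is safe then $z$ is also safe. Then there exists an optimal (minimum-cardinality) feasible FVC solution for $G$ that does not contain the edge $uw$.
   Context: An instance consists of a graph $G=(V,E)$ with $V$ partitioned into safe and unsafe vertices. A set $F\subseteq E$ is a feasible FVC solution if $(V,F)$ is connected and no unsafe vertex is a cut-vertex of $(V,F)$; an optimal solution is a feasible FVC solution of minimum cardinality. -}

module Defs where

open import Data.Nat using (ℕ; zero; suc; _+_; _≤_; _<ᵇ_)
open import Data.Bool using (Bool; true; false; if_then_else_; _∧_)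
open import Data.Fin using (Fin; toℕ)
open import Data.List using (List; map; allFin)
open import Data.Nat.ListAction using (sum)
open import Data.Product using (Σ; _×_; _,_)
open import Relation.Nullary using (¬_)
open import Relation.Binary.PropositionalEquality using (_≡_; _≢_)
open import Relation.Binary.Construct.Closure.ReflexiveTransitive using (Star)

EdgeRel : ℕ → Set
EdgeRel n = Fin n → Fin n → Bool

record SimpleGraph (n : ℕ) : Set where
  field
    adj   : EdgeRel n
    sym   : ∀ x y → adj x y ≡ adj y x
    loopless : ∀ x → adj x x ≡ false
open SimpleGraph public

-- Symmetric edge relations (edge sets of spanning subgraphs).
Symmetric : ∀ {n} → EdgeRel n → Set
Symmetric H = ∀ x y → H x y ≡ H y x

_⊆E_ : ∀ {n} → EdgeRel n → EdgeRel n → Set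
F ⊆E E = ∀ x y → F x y ≡ true → E x y ≡ true

Connected : ∀ {n} → EdgeRel n → Fin n → Fin n → Set
Connected H = Star (λ a b → H a b ≡ true)

ConnectedAvoiding : ∀ {n} → EdgeRel n → Fin n → Fin n → Fin n → Set
ConnectedAvoiding H c = Star (λ a b → (H a b ≡ true) × (a ≢ c) × (b ≢ c))

IsConnected : ∀ {n} → EdgeRel n → Set
IsConnected H = ∀ x y → Connected H x y

-- c is a cut-vertex of (V,H): deleting c disconnects two vertices that were
-- connected (i.e. deleting c increases the number of components).
IsCutVertex : ∀ {n} → EdgeRel n → Fin n → Set
IsCutVertex H c = Σ _ λ x → Σ _ λ y →
  (x ≢ c) × (y ≢ c) × Connected H x y × ¬ ConnectedAvoiding H c x y

TwoVertexConnected : ∀ {n} → SimpleGraph n → Set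
TwoVertexConnected {n} G =
  (3 ≤ n) × IsConnected (adj G) × (∀ c → ¬ IsCutVertex (adj G) c)

degree : ∀ {n} → SimpleGraph n → Fin n → ℕ
degree {n} G v = sum (map (λ j → if adj G v j then 1 else 0) (allFin n))

-- number of (undirected) edges of a symmetric edge relation:
-- counts pairs {i , j} with toℕ i < toℕ j.
edgeCount : ∀ {n} → EdgeRel n → ℕ
edgeCount {n} F =
  sum (map (λ i → sum (map (λ j → if F i j ∧ (toℕ i <ᵇ toℕ j) then 1 else 0)
                           (allFin n)))
           (allFin n))

FeasibleFVC : ∀ {n} → SimpleGraph n → (Fin n → Bool) → EdgeRel n → Set
FeasibleFVC G safe F =
  Symmetric F × (F ⊆E adj G) × IsConnected F ×
  (∀ c → safe c ≡ false → ¬ IsCutVertex F c)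

OptimalFVC : ∀ {n} → SimpleGraph n → (Fin n → Bool) → EdgeRel n → Set
OptimalFVC G safe F =
  FeasibleFVC G safe F × (∀ F' → FeasibleFVC G safe F' → edgeCount F ≤ edgeCount F')

-- Take an optimal solution F that contains uw. As w and z have degree 2, the cycle edges are
-- their only edges, and a case split on which of wv, uz, vz lie in F shows that uw can be
-- exchanged for another edge of G without losing feasibility. If wv ∉ F, then w is a leaf of F
-- and uw is exchanged for wv. If uz ∉ F, exchanging uw for uz gives the image of F under the
-- transposition of w and z; deleting z from it corresponds to deleting w from F, which is
-- harmless because z unsafe forces w unsafe. If vz ∉ F, uw is exchanged for vz and the path
-- u–z–v–w takes over the role of uw. If the whole cycle lies in F, then F − uw is feasible,
-- contradicting optimality, unless z is unsafe and no path of F − {w, z} joins u and v. In that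
-- case F − {w, z} falls into a part around u and a part around v; a path in G − v (or G − u)
-- from u (or v) to a fifth vertex leaves the first part through an edge ab of G into the
-- second, and uw is exchanged for ab.

module Submission where

open import Level using (0ℓ)
open import Function using (_∘_; Equivalence; mk⇔)
open import Data.Empty using (⊥; ⊥-elim)
open import Data.Unit using (tt)
open import Data.Bool using (Bool; true; false; if_then_else_; _∧_; _∨_; not)
open import Data.Bool.Properties using (∨-zeroʳ; T-≡; ¬-not) renaming (_≟_ to _≟ᵇ_)
open import Data.Nat using (ℕ; zero; suc; _+_; _≤_; _<_; _<ᵇ_; z≤n; s≤s)
open import Data.Nat.Properties
  using (≤-refl; ≤-trans; ≤-pred; <-irrefl; m<m+n; <-asym; <-cmp; _<?_; ≮⇒≥; <⇒≱; <⇒<ᵇ; <ᵇ⇒<;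
         +-identityʳ; +-mono-≤; +-cancelʳ-≡; +-commutativeSemigroup; module ≤-Reasoning)
open import Algebra.Properties.CommutativeSemigroup +-commutativeSemigroup using (interchange)
open import Data.Nat.ListAction using (sum)
open import Data.Fin using (Fin; zero; suc; toℕ; _≟_)
open import Data.Fin.Properties using (any?; all?; injective⇒≤; toℕ-injective)
open import Data.Fin.Permutation.Components using (transpose)
open import Data.List using (List; []; _∷_; map; allFin)
open import Data.List.Properties using (map-cong; map-tabulate)
open import Data.Vec.Functional using (head; tail) renaming (_∷_ to _∷ᶠ_)
open import Data.Vec.Functional.Relation.Binary.Pointwise using (Pointwise)
open import Data.Product using (Σ; ∃; _×_; _,_; proj₁; proj₂)
open import Data.Sum using (_⊎_; inj₁; inj₂; [_,_]′)
import Data.Sum as Sum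
open import Relation.Nullary using (Dec; yes; no; ¬_; does; proof; Reflects; invert)
open import Relation.Nullary.Decidable
  using (map′; _×-dec_; _⊎-dec_; _→-dec_; ¬?; dec-true; dec-false; does-⇔; decidable-stable)
open import Relation.Unary using (Pred; U)
open import Relation.Binary using (Rel; Reflexive; tri<; tri≈; tri>)
open import Relation.Binary.Definitions using (Decidable)
open import Relation.Binary.PropositionalEquality
  using (_≡_; _≢_; refl; sym; trans; cong; cong₂; subst; subst₂; ≢-sym)
open import Relation.Binary.Construct.Closure.ReflexiveTransitive
  using (Star; ε; _◅_; _◅◅_; gmap; kleisliStar; reverse)
open import Defs hiding (sym)

module _ {n : ℕ} {R : Rel (Fin (suc n)) 0ℓ} where

  -- A detour through vertex zero counts as a single step, so reachability in R between
  -- nonzero vertices is reachability in bypass, a relation on one vertex fewer.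
  bypass : Rel (Fin n) 0ℓ
  bypass a b = R (suc a) (suc b) ⊎ (R (suc a) zero × R zero (suc b))

  bypass? : Decidable R → Decidable bypass
  bypass? R? a b = R? (suc a) (suc b) ⊎-dec (R? (suc a) zero ×-dec R? zero (suc b))

  star-bypass⇒star : ∀ {a b} → Star bypass a b → Star R (suc a) (suc b)
  star-bypass⇒star = kleisliStar suc expand
    where
    expand : ∀ {a b} → bypass a b → Star R (suc a) (suc b)
    expand (inj₁ r) = r ◅ ε
    expand (inj₂ (r , r′)) = r ◅ r′ ◅ ε

  star⇒star-bypass : ∀ {a b} → Star R (suc a) (suc b) → Star bypass a b
  star-from-zero : ∀ {b} → Star R zero (suc b) → ∃ λ c → R zero (suc c) × Star bypass c b
  star⇒star-bypass ε = ε
  star⇒star-bypass (_◅_ {j = zero} r rs) with star-from-zero rs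
  ... | c , r′ , rs′ = inj₂ (r , r′) ◅ rs′
  star⇒star-bypass (_◅_ {j = suc c} r rs) = inj₁ r ◅ star⇒star-bypass rs
  star-from-zero (_◅_ {j = zero} _ rs) = star-from-zero rs
  star-from-zero (_◅_ {j = suc c} r rs) = c , r , star⇒star-bypass rs

  star-to-zero : ∀ {a} → Star R (suc a) zero → ∃ λ c → Star bypass a c × R (suc c) zero
  star-to-zero {a} (_◅_ {j = zero} r _) = a , ε , r
  star-to-zero (_◅_ {j = suc c} r rs) with star-to-zero rs
  ... | c′ , rs′ , r′ = c′ , inj₁ r ◅ rs′ , r′

star? : ∀ {n} {R : Rel (Fin n) 0ℓ} → Decidable R → Decidable (Star R)
star? {suc n} R? zero zero = yes ε
star? {suc n} R? zero (suc b) =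
  map′ (λ (c , r , rs) → r ◅ star-bypass⇒star rs) star-from-zero
       (any? λ c → R? zero (suc c) ×-dec star? (bypass? R?) c b)
star? {suc n} R? (suc a) zero =
  map′ (λ (c , rs , r) → star-bypass⇒star rs ◅◅ r ◅ ε) star-to-zero
       (any? λ c → star? (bypass? R?) a c ×-dec R? (suc c) zero)
star? {suc n} R? (suc a) (suc b) =
  map′ star-bypass⇒star star⇒star-bypass (star? (bypass? R?) a b)

-- Only predicates respecting _≈_ can be searched: on function types, the search produces
-- functions that are pointwise but not definitionally equal to the given ones.
Searchable : (A : Set) → Rel A 0ℓ → Set₁
Searchable A _≈_ =
  ∀ {P : Pred A 0ℓ} → (∀ {x y} → x ≈ y → P x → P y) → (∀ x → Dec (P x)) → Dec (∃ P)

searchable-Bool : Searchable Bool _≡_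
searchable-Bool {P} _ P? with P? false | P? true
... | yes p | _ = yes (false , p)
... | no _ | yes p = yes (true , p)
... | no ¬f | no ¬t = no λ { (false , p) → ¬f p ; (true , p) → ¬t p }

searchable-Vector : ∀ {A _≈_} → Reflexive _≈_ → Searchable A _≈_ →
  ∀ n → Searchable (Fin n → A) (Pointwise _≈_)
searchable-Vector ≈-refl search zero resp P? =
  map′ (λ p → empty , p) (λ (f , p) → resp (λ ()) p) (P? empty)
  where
  empty : Fin zero → _
  empty ()
searchable-Vector {_≈_ = _≈_} ≈-refl search (suc n) {P} resp P? =
  map′ (λ (a , f , p) → a ∷ᶠ f , p) (λ (f , p) → head f , tail f , resp eta p)
    (search (λ a≈b (f , p) → f , resp (head-cong a≈b) p)
      (λ a → searchable-Vector ≈-refl search n (resp ∘ tail-cong) (P? ∘ (a ∷ᶠ_))))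
  where
  eta : ∀ {f} → Pointwise _≈_ f (head f ∷ᶠ tail f)
  eta zero = ≈-refl
  eta (suc i) = ≈-refl
  head-cong : ∀ {a b f} → a ≈ b → Pointwise _≈_ (a ∷ᶠ f) (b ∷ᶠ f)
  head-cong a≈b zero = a≈b
  head-cong a≈b (suc i) = ≈-refl
  tail-cong : ∀ {a f g} → Pointwise _≈_ f g → Pointwise _≈_ (a ∷ᶠ f) (a ∷ᶠ g)
  tail-cong f≈g zero = ≈-refl
  tail-cong f≈g (suc i) = f≈g i

module _ {A : Set} {_≈_ : Rel A 0ℓ} (search : Searchable A _≈_)
         {P : Pred A 0ℓ} (resp : ∀ {x y} → x ≈ y → P x → P y) (P? : ∀ x → Dec (P x))
         (m : A → ℕ) (m-resp : ∀ {x y} → x ≈ y → m x ≡ m y) where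

  minimal-exists : ∀ {x} → P x → ∃ λ y → P y × (∀ z → P z → m y ≤ m z)
  minimal-exists {x} px = descend (m x) px ≤-refl
    where
    smaller? : ∀ k → Dec (∃ λ z → P z × m z < k)
    smaller? k = search (λ x≈y (p , lt) → resp x≈y p , subst (_< k) (m-resp x≈y) lt)
                        (λ z → P? z ×-dec m z <? k)
    descend : ∀ k {y} → P y → m y ≤ k → ∃ λ y → P y × (∀ z → P z → m y ≤ m z)
    descend zero {y} py y≤0 = y , py , λ _ _ → ≤-trans y≤0 z≤n
    descend (suc k) {y} py y≤k with smaller? (m y)
    ... | yes (z , pz , z<y) = descend k pz (≤-pred (≤-trans z<y y≤k))
    ... | no ¬smaller = y , py , λ z pz → ≮⇒≥ (λ z<y → ¬smaller (z , pz , z<y))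

false≢true : false ≢ true
false≢true ()

module _ {n : ℕ} where

  Path : EdgeRel n → Pred (Fin n) 0ℓ → Fin n → Fin n → Set
  Path H Ok = Star (λ a b → (H a b ≡ true) × Ok a × Ok b)

  ConnectedOn : EdgeRel n → Pred (Fin n) 0ℓ → Set
  ConnectedOn H Ok = ∀ x y → Ok x → Ok y → Path H Ok x y

  path? : (H : EdgeRel n) {Ok : Pred (Fin n) 0ℓ} → (∀ a → Dec (Ok a)) → Decidable (Path H Ok)
  path? H Ok? = star? (λ a b → (H a b ≟ᵇ true) ×-dec Ok? a ×-dec Ok? b)

  path-reverse : ∀ {H Ok} → Symmetric H → ∀ {x y} → Path H Ok x y → Path H Ok y x
  path-reverse H-sym = reverse (λ {a} {b} (e , oa , ob) → trans (H-sym b a) e , ob , oa)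

  module _ {H : EdgeRel n} {Ok : Pred (Fin n) 0ℓ} where

    edge⇒path : ∀ {a b} → H a b ≡ true → Ok a → Ok b → Path H Ok a b
    edge⇒path e oa ob = (e , oa , ob) ◅ ε

    path-okʳ : ∀ {x y} → Path H Ok x y → Ok x → Ok y
    path-okʳ ε ox = ox
    path-okʳ ((_ , _ , ob) ◅ p) _ = path-okʳ p ob

    path⇒connected : ∀ {x y} → Path H Ok x y → Connected H x y
    path⇒connected = gmap (λ x → x) proj₁

    path-crossing : (T : Pred (Fin n) 0ℓ) → (∀ a → Dec (T a)) → ∀ {s t} →
      Path H Ok s t → T s → ¬ T t →
      ∃ λ a → ∃ λ b → (H a b ≡ true) × Ok a × Ok b × T a × ¬ T b
    path-crossing T T? ε ts ¬tt = ⊥-elim (¬tt ts)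
    path-crossing T T? (_◅_ {j = m} (e , oa , om) p) ts ¬tt with T? m
    ... | yes tm = path-crossing T T? p tm ¬tt
    ... | no ¬tm = _ , m , e , oa , om , ts , ¬tm

    module _ {H′ : EdgeRel n} {Ok′ : Pred (Fin n) 0ℓ} where

      path-map : (f : Fin n → Fin n) →
        (∀ {a b} → H a b ≡ true → Ok a → Ok b → Path H′ Ok′ (f a) (f b)) →
        ∀ {x y} → Path H Ok x y → Path H′ Ok′ (f x) (f y)
      path-map f edge-image = kleisliStar f (λ (e , oa , ob) → edge-image e oa ob)

      path-mono : (∀ {a b} → H a b ≡ true → Ok a → Ok b → (H′ a b ≡ true) × Ok′ a × Ok′ b) →
        ∀ {x y} → Path H Ok x y → Path H′ Ok′ x y
      path-mono edge-mono = gmap (λ x → x) (λ (e , oa , ob) → edge-mono e oa ob)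

      connectedOn-image : Symmetric H′ → (f : Fin n → Fin n) →
        (∀ {a b} → H a b ≡ true → Ok a → Ok b → Path H′ Ok′ (f a) (f b)) →
        (∀ x → Ok′ x → ∃ λ y → Ok y × Path H′ Ok′ x (f y)) →
        ConnectedOn H Ok → ConnectedOn H′ Ok′
      connectedOn-image H′-sym f edge-image reach conn x y ox oy
        with reach x ox | reach y oy
      ... | x₀ , ox₀ , px | y₀ , oy₀ , py =
        px ◅◅ path-map f edge-image (conn x₀ y₀ ox₀ oy₀) ◅◅ path-reverse H′-sym py

      connectedOn-involution : ∀ {σ : Fin n → Fin n} → (∀ x → σ (σ x) ≡ x) → Symmetric H′ →
        (∀ {a b} → H a b ≡ true → H′ (σ a) (σ b) ≡ true) →
        (∀ {a} → Ok a → Ok′ (σ a)) → (∀ {x} → Ok′ x → Ok (σ x)) →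
        ConnectedOn H Ok → ConnectedOn H′ Ok′
      connectedOn-involution {σ} σ-inv H′-sym σ-edge ok⇒ ok⇐ =
        connectedOn-image H′-sym σ (λ e oa ob → (σ-edge e , ok⇒ oa , ok⇒ ob) ◅ ε)
          (λ x ox → σ x , ok⇐ ox , subst (Path H′ Ok′ x) (sym (σ-inv x)) ε)

  connected⇒path : ∀ {H x y} → Connected H x y → Path H U x y
  connected⇒path = gmap (λ x → x) (λ e → e , tt , tt)

  star-first-step : ∀ {R : Rel (Fin n) 0ℓ} {x y} → Star R x y → x ≢ y → ∃ (R x)
  star-first-step ε x≢x = ⊥-elim (x≢x refl)
  star-first-step (r ◅ _) _ = _ , r

  non-cut⇒path : ∀ {H c x y} → ¬ IsCutVertex H c → Connected H x y → x ≢ c → y ≢ c →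
    Path H (_≢ c) x y
  non-cut⇒path {H} {c} {x} {y} ¬cut cxy x≢c y≢c with path? H (λ a → ¬? (a ≟ c)) x y
  ... | yes p = p
  ... | no ¬p = ⊥-elim (¬cut (x , y , x≢c , y≢c , cxy , ¬p))

  module _ (q p : Fin n) where

    collapse : Fin n → Fin n
    collapse a with a ≟ q
    ... | yes _ = p
    ... | no _ = a

    collapse-q : collapse q ≡ p
    collapse-q with q ≟ q
    ... | yes _ = refl
    ... | no q≢q = ⊥-elim (q≢q refl)

    collapse-other : ∀ {a} → a ≢ q → collapse a ≡ a
    collapse-other {a} a≢q with a ≟ q
    ... | yes a≡q = ⊥-elim (a≢q a≡q)
    ... | no _ = refl

  -- A leaf q hanging on p is contracted into p, so F-paths become F′-paths.
  connectedOn-contract-leaf : ∀ {F F′ : EdgeRel n} {Ok Ok′ : Pred (Fin n) 0ℓ} {p q} →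
    Symmetric F → Symmetric F′ → p ≢ q → (∀ {b} → F q b ≡ true → b ≡ p) →
    (∀ {a b} → F a b ≡ true → Ok a → Ok b → a ≢ q → b ≢ q → Path F′ Ok′ a b) →
    (∀ x → Ok′ x → ∃ λ y → Ok y × y ≢ q × Path F′ Ok′ x y) →
    ConnectedOn F Ok → ConnectedOn F′ Ok′
  connectedOn-contract-leaf {F} {F′} {Ok} {Ok′} {p} {q} F-sym F′-sym p≢q leaf kept reach =
    connectedOn-image F′-sym (collapse q p) edge-image reach′
    where
    onto-p : ∀ {a} → a ≡ q ⊎ a ≡ p → collapse q p a ≡ p
    onto-p (inj₁ refl) = collapse-q q p
    onto-p (inj₂ refl) = collapse-other q p p≢q
    both-onto-p : ∀ {a b} → a ≡ q ⊎ a ≡ p → b ≡ q ⊎ b ≡ p →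
      Path F′ Ok′ (collapse q p a) (collapse q p b)
    both-onto-p a∈qp b∈qp = subst₂ (Path F′ Ok′) (sym (onto-p a∈qp)) (sym (onto-p b∈qp)) ε
    edge-image : ∀ {a b} → F a b ≡ true → Ok a → Ok b → Path F′ Ok′ (collapse q p a) (collapse q p b)
    edge-image {a} {b} e oa ob = by-cases (a ≟ q) (b ≟ q)
      where
      by-cases : Dec (a ≡ q) → Dec (b ≡ q) → Path F′ Ok′ (collapse q p a) (collapse q p b)
      by-cases (yes a≡q) _ = both-onto-p (inj₁ a≡q) (inj₂ (leaf (subst (λ t → F t b ≡ true) a≡q e)))
      by-cases (no _) (yes b≡q) =
        both-onto-p (inj₂ (leaf (trans (F-sym q a) (subst (λ t → F a t ≡ true) b≡q e)))) (inj₁ b≡q)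
      by-cases (no a≢q) (no b≢q) =
        subst₂ (Path F′ Ok′) (sym (collapse-other q p a≢q)) (sym (collapse-other q p b≢q))
               (kept e oa ob a≢q b≢q)
    reach′ : ∀ x → Ok′ x → ∃ λ y → Ok y × Path F′ Ok′ x (collapse q p y)
    reach′ x ox with reach x ox
    ... | y , oy , y≢q , pxy = y , oy , subst (Path F′ Ok′ x) (sym (collapse-other q p y≢q)) pxy

  connectedOn-delete-leaf : ∀ {H : EdgeRel n} {p q} → Symmetric H → p ≢ q →
    (∀ {b} → H q b ≡ true → b ≡ p) → ConnectedOn H U → ConnectedOn H (_≢ q)
  connectedOn-delete-leaf H-sym p≢q leaf =
    connectedOn-contract-leaf H-sym H-sym p≢q leaf
      (λ e _ _ a≢q b≢q → edge⇒path e a≢q b≢q) (λ x x≢q → x , tt , x≢q , ε)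

module _ {n : ℕ} where

  IsPair : Fin n → Fin n → Fin n → Fin n → Set
  IsPair p q a b = (a ≡ p × b ≡ q) ⊎ (a ≡ q × b ≡ p)

  isPair? : ∀ p q a b → Dec (IsPair p q a b)
  isPair? p q a b = (a ≟ p ×-dec b ≟ q) ⊎-dec (a ≟ q ×-dec b ≟ p)

  edge : Fin n → Fin n → EdgeRel n
  edge p q a b = does (isPair? p q a b)

  module _ (p q : Fin n) where

    edge-true : ∀ {a b} → edge p q a b ≡ true → IsPair p q a b
    edge-true {a} {b} e = invert (subst (Reflects _) e (proof (isPair? p q a b)))

    edge-false : ∀ {a b} → ¬ IsPair p q a b → edge p q a b ≡ false
    edge-false = dec-false (isPair? p q _ _)

    edge-pq : edge p q p q ≡ true
    edge-pq = dec-true (isPair? p q p q) (inj₁ (refl , refl))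

    edge-qp : edge p q q p ≡ true
    edge-qp = dec-true (isPair? p q q p) (inj₂ (refl , refl))

    edge-sym : Symmetric (edge p q)
    edge-sym a b = does-⇔ (mk⇔ flip flip) (isPair? p q a b) (isPair? p q b a)
      where
      flip : ∀ {a b} → IsPair p q a b → IsPair p q b a
      flip (inj₁ (a≡p , b≡q)) = inj₂ (b≡q , a≡p)
      flip (inj₂ (a≡q , b≡p)) = inj₁ (b≡p , a≡q)

    edge-falseˡ : ∀ {a} b → a ≢ p → a ≢ q → edge p q a b ≡ false
    edge-falseˡ {a} b a≢p a≢q = edge-false {a} {b} λ where
      (inj₁ (a≡p , _)) → a≢p a≡p
      (inj₂ (a≡q , _)) → a≢q a≡q

    edge-falseʳ : ∀ a {b} → b ≢ p → b ≢ q → edge p q a b ≡ false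
    edge-falseʳ a {b} b≢p b≢q = edge-false {a} {b} λ where
      (inj₁ (_ , b≡q)) → b≢q b≡q
      (inj₂ (_ , b≡p)) → b≢p b≡p

    edge-false-q : ∀ {a b} → a ≢ q → b ≢ q → edge p q a b ≡ false
    edge-false-q {a} {b} a≢q b≢q = edge-false {a} {b} λ where
      (inj₁ (_ , b≡q)) → b≢q b≡q
      (inj₂ (a≡q , _)) → a≢q a≡q

    edge⇒≡ : ∀ {F : EdgeRel n} → Symmetric F → ∀ {a b} → edge p q a b ≡ true → F a b ≡ F p q
    edge⇒≡ F-sym {a} {b} e with edge-true {a} {b} e
    ... | inj₁ (refl , refl) = refl
    ... | inj₂ (refl , refl) = F-sym q p

  remove : EdgeRel n → Fin n → Fin n → EdgeRel n
  remove F p q a b = not (edge p q a b) ∧ F a b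

  insert : EdgeRel n → Fin n → Fin n → EdgeRel n
  insert F r s a b = edge r s a b ∨ F a b

  replace : EdgeRel n → Fin n → Fin n → Fin n → Fin n → EdgeRel n
  replace F p q r s = remove (insert F r s) p q

  module _ (F : EdgeRel n) (p q : Fin n) where

    remove-keeps : ∀ {a b} → edge p q a b ≡ false → F a b ≡ true → remove F p q a b ≡ true
    remove-keeps pq-ab Fab rewrite pq-ab = Fab

    remove-pq : remove F p q p q ≡ false
    remove-pq rewrite edge-pq p q = refl

    remove-sym : Symmetric F → Symmetric (remove F p q)
    remove-sym F-sym a b = cong₂ (λ x y → not x ∧ y) (edge-sym p q a b) (F-sym a b)

    remove-⊆ : remove F p q ⊆E F
    remove-⊆ a b e with edge p q a b
    ... | false = e

    insert-keeps : ∀ {a b} → F a b ≡ true → insert F p q a b ≡ true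
    insert-keeps {a} {b} Fab rewrite Fab = ∨-zeroʳ (edge p q a b)

    insert-sym : Symmetric F → Symmetric (insert F p q)
    insert-sym F-sym a b = cong₂ _∨_ (edge-sym p q a b) (F-sym a b)

    insert-⊆ : ∀ {E} → Symmetric E → E p q ≡ true → F ⊆E E → insert F p q ⊆E E
    insert-⊆ E-sym Epq F⊆E a b e with edge p q a b in pq-ab
    ... | true = trans (edge⇒≡ p q E-sym pq-ab) Epq
    ... | false = F⊆E a b e

  module _ (F : EdgeRel n) (p q r s : Fin n) where

    replace-keeps : ∀ {a b} → edge p q a b ≡ false → F a b ≡ true → replace F p q r s a b ≡ true
    replace-keeps pq-ab Fab = remove-keeps (insert F r s) p q pq-ab (insert-keeps F r s Fab)

    replace-rs : edge p q r s ≡ false → replace F p q r s r s ≡ true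
    replace-rs pq-rs = remove-keeps (insert F r s) p q pq-rs (cong (_∨ F r s) (edge-pq r s))

    replace-sr : edge p q s r ≡ false → replace F p q r s s r ≡ true
    replace-sr pq-sr = remove-keeps (insert F r s) p q pq-sr (cong (_∨ F s r) (edge-qp r s))

    replace-pq : replace F p q r s p q ≡ false
    replace-pq = remove-pq (insert F r s) p q

    replace-sym : Symmetric F → Symmetric (replace F p q r s)
    replace-sym F-sym = remove-sym (insert F r s) p q (insert-sym F r s F-sym)

    replace-⊆ : ∀ {E} → Symmetric E → E r s ≡ true → F ⊆E E → replace F p q r s ⊆E E
    replace-⊆ E-sym Ers F⊆E a b e =
      insert-⊆ F r s E-sym Ers F⊆E a b (remove-⊆ (insert F r s) p q a b e)

  connectedOn-detour : ∀ {F F′ : EdgeRel n} {Ok : Pred (Fin n) 0ℓ} {p q} → Symmetric F′ →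
    (∀ {a b} → edge p q a b ≡ false → F a b ≡ true → F′ a b ≡ true) →
    (Ok p → Ok q → Path F′ Ok p q) → ConnectedOn F Ok → ConnectedOn F′ Ok
  connectedOn-detour {F} {F′} {Ok} {p} {q} F′-sym kept detour =
    connectedOn-image F′-sym (λ x → x) edge-image (λ x ox → x , ox , ε)
    where
    edge-image : ∀ {a b} → F a b ≡ true → Ok a → Ok b → Path F′ Ok a b
    edge-image {a} {b} e oa ob with isPair? p q a b
    ... | yes (inj₁ (refl , refl)) = detour oa ob
    ... | yes (inj₂ (refl , refl)) = path-reverse F′-sym (detour ob oa)
    ... | no ¬pq = edge⇒path (kept (edge-false p q ¬pq) e) oa ob

sum-map-+ : ∀ {A : Set} (f g : A → ℕ) (xs : List A) →
  sum (map f xs) + sum (map g xs) ≡ sum (map (λ x → f x + g x) xs)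
sum-map-+ f g [] = refl
sum-map-+ f g (x ∷ xs) =
  trans (interchange (f x) _ (g x) _) (cong (f x + g x +_) (sum-map-+ f g xs))

sum-map-0 : ∀ {A : Set} (xs : List A) → sum (map (λ _ → 0) xs) ≡ 0
sum-map-0 [] = refl
sum-map-0 (_ ∷ xs) = sum-map-0 xs

sum-map-mono : ∀ {A : Set} {f g : A → ℕ} → (∀ x → f x ≤ g x) →
  ∀ xs → sum (map f xs) ≤ sum (map g xs)
sum-map-mono f≤g [] = z≤n
sum-map-mono f≤g (x ∷ xs) = +-mono-≤ (f≤g x) (sum-map-mono f≤g xs)

sum-allFin-suc : ∀ n (f : Fin (suc n) → ℕ) →
  sum (map f (allFin (suc n))) ≡ f zero + sum (map (f ∘ suc) (allFin n))
sum-allFin-suc n f = cong (f zero +_) (cong sum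
  (trans (map-tabulate suc f) (sym (map-tabulate (λ i → i) (f ∘ suc)))))

indicator : Bool → ℕ
indicator b = if b then 1 else 0

sum-indicator-≟ : ∀ n (q : Fin n) → sum (map (λ j → indicator (does (j ≟ q))) (allFin n)) ≡ 1
sum-indicator-≟ (suc n) q = trans (sum-allFin-suc n (λ j → indicator (does (j ≟ q)))) (by-cases q)
  where
  by-cases : ∀ q →
    indicator (does (zero ≟ q)) + sum (map (λ j → indicator (does (suc j ≟ q))) (allFin n)) ≡ 1
  by-cases zero = cong suc (sum-map-0 (allFin n))
  by-cases (suc q) = sum-indicator-≟ n q

<ᵇ-true : ∀ {m k} → m < k → (m <ᵇ k) ≡ true
<ᵇ-true m<k = Equivalence.to T-≡ (<⇒<ᵇ m<k)

<ᵇ-false : ∀ {m k} → k < m → (m <ᵇ k) ≡ false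
<ᵇ-false {m} {k} k<m = ¬-not λ m<ᵇk → <-asym k<m (<ᵇ⇒< m k (Equivalence.from T-≡ m<ᵇk))

module _ {n : ℕ} where

  cell : EdgeRel n → Fin n → Fin n → ℕ
  cell F i j = indicator (F i j ∧ (toℕ i <ᵇ toℕ j))

  edgeCount-cellwise : ∀ {F F′ F″ : EdgeRel n} →
    (∀ i j → cell F i j + cell F′ i j ≡ cell F″ i j) → edgeCount F + edgeCount F′ ≡ edgeCount F″
  edgeCount-cellwise {F} {F′} h = trans (sum-map-+ _ _ (allFin n)) (cong sum (map-cong
    (λ i → trans (sum-map-+ (cell F i) (cell F′ i) (allFin n)) (cong sum (map-cong (h i) (allFin n))))
    (allFin n)))

  edgeCount-cong : ∀ {F F′ : EdgeRel n} → Pointwise (Pointwise _≡_) F F′ → edgeCount F ≡ edgeCount F′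
  edgeCount-cong {F} F≗F′ = cong sum (map-cong
    (λ i → cong sum (map-cong (λ j → cong (λ b → indicator (b ∧ _)) (F≗F′ i j)) (allFin n)))
    (allFin n))

  edgeCount-edge< : ∀ {p q : Fin n} → toℕ p < toℕ q → edgeCount (edge p q) ≡ 1
  edgeCount-edge< {p} {q} p<q = trans (cong sum (map-cong row (allFin n))) (sum-indicator-≟ n p)
    where
    cell-p : ∀ j → cell (edge p q) p j ≡ indicator (does (j ≟ q))
    cell-p j = by-cases (j ≟ q)
      where
      by-cases : Dec (j ≡ q) → cell (edge p q) p j ≡ indicator (does (j ≟ q))
      by-cases (yes refl)
        rewrite edge-pq p q | <ᵇ-true p<q | dec-true (q ≟ q) refl = refl
      by-cases (no j≢q) rewrite edge-false p q {p} {j} (λ where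
          (inj₁ (_ , j≡q)) → j≢q j≡q
          (inj₂ (p≡q , _)) → <-irrefl (cong toℕ p≡q) p<q)
        | dec-false (j ≟ q) j≢q = refl
    cell-other : ∀ {i} → i ≢ p → ∀ j → cell (edge p q) i j ≡ 0
    cell-other {i} i≢p j = by-cases (isPair? p q i j)
      where
      by-cases : Dec (IsPair p q i j) → cell (edge p q) i j ≡ 0
      by-cases (no ¬pq) rewrite edge-false p q {i} {j} ¬pq = refl
      by-cases (yes (inj₁ (i≡p , _))) = ⊥-elim (i≢p i≡p)
      by-cases (yes (inj₂ (refl , refl))) rewrite edge-qp p q | <ᵇ-false p<q = refl
    row : ∀ i → sum (map (cell (edge p q) i) (allFin n)) ≡ indicator (does (i ≟ p))
    row i = by-cases (i ≟ p)
      where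
      by-cases : Dec (i ≡ p) → sum (map (cell (edge p q) i) (allFin n)) ≡ indicator (does (i ≟ p))
      by-cases (yes refl) = trans (cong sum (map-cong cell-p (allFin n)))
        (trans (sum-indicator-≟ n q) (cong indicator (sym (dec-true (i ≟ i) refl))))
      by-cases (no i≢p) = trans (cong sum (map-cong (cell-other i≢p) (allFin n)))
        (trans (sum-map-0 (allFin n)) (cong indicator (sym (dec-false (i ≟ p) i≢p))))

  edgeCount-edge : ∀ {p q : Fin n} → p ≢ q → edgeCount (edge p q) ≡ 1
  edgeCount-edge {p} {q} p≢q with <-cmp (toℕ p) (toℕ q)
  ... | tri< p<q _ _ = edgeCount-edge< p<q
  ... | tri≈ _ p≡q _ = ⊥-elim (p≢q (toℕ-injective p≡q))
  ... | tri> _ _ q<p = trans (edgeCount-cong edge-comm) (edgeCount-edge< q<p)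
    where
    edge-comm : Pointwise (Pointwise _≡_) (edge p q) (edge q p)
    edge-comm a b = does-⇔ (mk⇔ Sum.swap Sum.swap) (isPair? p q a b) (isPair? q p a b)

  remove-cell : ∀ x f c → (x ≡ true → f ≡ true) →
    indicator ((not x ∧ f) ∧ c) + indicator (x ∧ c) ≡ indicator (f ∧ c)
  remove-cell true f c f-true rewrite f-true refl = refl
  remove-cell false f c _ = +-identityʳ _

  insert-cell : ∀ x f c → (x ≡ true → f ≡ false) →
    indicator ((x ∨ f) ∧ c) ≡ indicator (f ∧ c) + indicator (x ∧ c)
  insert-cell true f c f-false rewrite f-false refl = refl
  insert-cell false f c _ = sym (+-identityʳ _)

  edgeCount-remove : ∀ {F : EdgeRel n} {p q} → Symmetric F → p ≢ q → F p q ≡ true →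
    edgeCount (remove F p q) + 1 ≡ edgeCount F
  edgeCount-remove {F} {p} {q} F-sym p≢q Fpq =
    trans (cong (edgeCount (remove F p q) +_) (sym (edgeCount-edge p≢q)))
          (edgeCount-cellwise λ i j →
            remove-cell (edge p q i j) _ _ (λ e → trans (edge⇒≡ p q F-sym e) Fpq))

  edgeCount-insert : ∀ {F : EdgeRel n} {r s} → Symmetric F → r ≢ s → F r s ≡ false →
    edgeCount (insert F r s) ≡ edgeCount F + 1
  edgeCount-insert {F} {r} {s} F-sym r≢s Frs =
    trans (sym (edgeCount-cellwise λ i j →
                 sym (insert-cell (edge r s i j) _ _ (λ e → trans (edge⇒≡ r s F-sym e) Frs))))
          (cong (edgeCount F +_) (edgeCount-edge r≢s))

  edgeCount-replace : ∀ {F : EdgeRel n} {p q r s} → Symmetric F → p ≢ q → r ≢ s →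
    F p q ≡ true → F r s ≡ false → edgeCount (replace F p q r s) ≡ edgeCount F
  edgeCount-replace {F} {p} {q} {r} {s} F-sym p≢q r≢s Fpq Frs = +-cancelʳ-≡ 1 _ _
    (trans (edgeCount-remove (insert-sym F r s F-sym) p≢q (insert-keeps F r s Fpq))
           (edgeCount-insert F-sym r≢s Frs))

module _ {n : ℕ} where

  connected? : (H : EdgeRel n) → Decidable (Connected H)
  connected? H = star? (λ a b → H a b ≟ᵇ true)

  cutVertex? : (H : EdgeRel n) → ∀ c → Dec (IsCutVertex H c)
  cutVertex? H c = any? λ x → any? λ y →
    ¬? (x ≟ c) ×-dec ¬? (y ≟ c) ×-dec connected? H x y ×-dec ¬? (path? H (λ a → ¬? (a ≟ c)) x y)

  connected⇒connectedOn : ∀ {H : EdgeRel n} → IsConnected H → ConnectedOn H U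
  connected⇒connectedOn H-conn x y _ _ = connected⇒path (H-conn x y)

  non-cut⇒connectedOn : ∀ {H : EdgeRel n} {c} → IsConnected H → ¬ IsCutVertex H c →
    ConnectedOn H (_≢ c)
  non-cut⇒connectedOn H-conn ¬cut x y = non-cut⇒path ¬cut (H-conn x y)

  module _ (G : SimpleGraph n) (safe : Fin n → Bool) where

    feasible-intro : ∀ {F} → Symmetric F → F ⊆E adj G → ConnectedOn F U →
      (∀ c → safe c ≡ false → ConnectedOn F (_≢ c)) → FeasibleFVC G safe F
    feasible-intro F-sym F⊆E F-conn F-conn-without =
      F-sym , F⊆E , (λ x y → path⇒connected (F-conn x y tt tt)) ,
      λ c unsafe (x , y , x≢c , y≢c , _ , ¬path) → ¬path (F-conn-without c unsafe x y x≢c y≢c)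

    feasible⇒connectedOn : ∀ {F} → FeasibleFVC G safe F → ConnectedOn F U
    feasible⇒connectedOn (_ , _ , F-conn , _) = connected⇒connectedOn F-conn

    feasible⇒connectedOn-unsafe : ∀ {F c} → FeasibleFVC G safe F → safe c ≡ false →
      ConnectedOn F (_≢ c)
    feasible⇒connectedOn-unsafe (_ , _ , F-conn , F-cut) unsafe =
      non-cut⇒connectedOn F-conn (F-cut _ unsafe)

    feasible? : ∀ F → Dec (FeasibleFVC G safe F)
    feasible? F =
      (all? λ x → all? λ y → F x y ≟ᵇ F y x) ×-dec
      (all? λ x → all? λ y → (F x y ≟ᵇ true) →-dec (adj G x y ≟ᵇ true)) ×-dec
      (all? λ x → all? λ y → connected? F x y) ×-dec
      (all? λ c → (safe c ≟ᵇ false) →-dec ¬? (cutVertex? F c))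

    feasible-resp : ∀ {F F′} → Pointwise (Pointwise _≡_) F F′ →
      FeasibleFVC G safe F → FeasibleFVC G safe F′
    feasible-resp {F} {F′} F≗F′ (F-sym , F⊆E , F-conn , F-cut) =
      (λ x y → trans (sym (F≗F′ x y)) (trans (F-sym x y) (F≗F′ y x))) ,
      (λ x y e → F⊆E x y (trans (F≗F′ x y) e)) ,
      (λ x y → gmap (λ a → a) (to F≗F′) (F-conn x y)) ,
      λ c unsafe (x , y , x≢c , y≢c , cxy , ¬path) →
        F-cut c unsafe (x , y , x≢c , y≢c , gmap (λ a → a) (to (λ a b → sym (F≗F′ a b))) cxy ,
                        ¬path ∘ path-mono (λ e oa ob → to F≗F′ e , oa , ob))
      where
      to : ∀ {H H′ : EdgeRel n} → Pointwise (Pointwise _≡_) H H′ →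
        ∀ {a b} → H a b ≡ true → H′ a b ≡ true
      to H≗H′ {a} {b} e = trans (sym (H≗H′ a b)) e

    optimal-exists : ∀ {F₀} → FeasibleFVC G safe F₀ → Σ (EdgeRel n) (OptimalFVC G safe)
    optimal-exists = minimal-exists search feasible-resp feasible? edgeCount edgeCount-cong
      where
      search : Searchable (EdgeRel n) (Pointwise (Pointwise _≡_))
      search = searchable-Vector (λ _ → refl) (searchable-Vector refl searchable-Bool n) n

    twoConnected⇒feasible : TwoVertexConnected G → FeasibleFVC G safe (adj G)
    twoConnected⇒feasible (_ , G-conn , G-cut) =
      SimpleGraph.sym G , (λ _ _ e → e) , G-conn , λ c _ → G-cut c

degree-2-neighbour : ∀ {n} (G : SimpleGraph n) {w u v} → u ≢ v →
  adj G w u ≡ true → adj G w v ≡ true → degree G w ≡ 2 →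
  ∀ {b} → adj G w b ≡ true → b ≡ u ⊎ b ≡ v
degree-2-neighbour {n} G {w} {u} {v} u≢v wu wv deg-w {b} wb with b ≟ u | b ≟ v
... | yes b≡u | _ = inj₁ b≡u
... | no _ | yes b≡v = inj₂ b≡v
... | no b≢u | no b≢v = ⊥-elim (<⇒≱ (s≤s (s≤s (s≤s z≤n))) (begin
  3                                              ≡⟨ three-indicators ⟨
  total (λ j → [ j ≟ u ] + [ j ≟ v ] + [ j ≟ b ]) ≤⟨ sum-map-mono bounded (allFin n) ⟩
  degree G w                                     ≡⟨ deg-w ⟩
  2                                              ∎))
  where
  open ≤-Reasoning
  total : (Fin n → ℕ) → ℕ
  total f = sum (map f (allFin n))
  [_] : ∀ {j k : Fin n} → Dec (j ≡ k) → ℕ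
  [ j≟k ] = indicator (does j≟k)
  three-indicators : total (λ j → [ j ≟ u ] + [ j ≟ v ] + [ j ≟ b ]) ≡ 3
  three-indicators = begin-equality
    total (λ j → [ j ≟ u ] + [ j ≟ v ] + [ j ≟ b ])
      ≡⟨ sum-map-+ (λ j → [ j ≟ u ] + [ j ≟ v ]) (λ j → [ j ≟ b ]) (allFin n) ⟨
    total (λ j → [ j ≟ u ] + [ j ≟ v ]) + total (λ j → [ j ≟ b ])
      ≡⟨ cong (_+ total (λ j → [ j ≟ b ]))
              (sum-map-+ (λ j → [ j ≟ u ]) (λ j → [ j ≟ v ]) (allFin n)) ⟨
    total (λ j → [ j ≟ u ]) + total (λ j → [ j ≟ v ]) + total (λ j → [ j ≟ b ])
      ≡⟨ cong₂ _+_ (cong₂ _+_ (sum-indicator-≟ n u) (sum-indicator-≟ n v)) (sum-indicator-≟ n b) ⟩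
    3 ∎
  adjacent : ∀ {j k} → j ≡ k → adj G w k ≡ true → 1 ≤ indicator (adj G w j)
  adjacent refl e rewrite e = ≤-refl
  bounded : ∀ j → [ j ≟ u ] + [ j ≟ v ] + [ j ≟ b ] ≤ indicator (adj G w j)
  bounded j with j ≟ u | j ≟ v | j ≟ b
  ... | yes j≡u | yes j≡v | _ = ⊥-elim (u≢v (trans (sym j≡u) j≡v))
  ... | yes j≡u | no _ | yes j≡b = ⊥-elim (b≢u (trans (sym j≡b) j≡u))
  ... | no _ | yes j≡v | yes j≡b = ⊥-elim (b≢v (trans (sym j≡b) j≡v))
  ... | yes j≡u | no _ | no _ = adjacent j≡u wu
  ... | no _ | yes j≡v | no _ = adjacent j≡v wv
  ... | no _ | no _ | yes j≡b = adjacent j≡b wb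
  ... | no _ | no _ | no _ = z≤n

fifth-vertex : ∀ {n} → 5 ≤ n → (a b c d : Fin n) → ∃ λ x → x ≢ a × x ≢ b × x ≢ c × x ≢ d
fifth-vertex {n} 5≤n a b c d
  with any? (λ x → ¬? (x ≟ a) ×-dec ¬? (x ≟ b) ×-dec ¬? (x ≟ c) ×-dec ¬? (x ≟ d))
... | yes fifth = fifth
... | no ¬fifth = ⊥-elim (<⇒≱ 5≤n (injective⇒≤ {f = index} index-injective))
  where
  index : Fin n → Fin 4
  index x with x ≟ a | x ≟ b | x ≟ c
  ... | yes _ | _ | _ = zero
  ... | no _ | yes _ | _ = suc zero
  ... | no _ | no _ | yes _ = suc (suc zero)
  ... | no _ | no _ | no _ = suc (suc (suc zero))
  vertex : Fin 4 → Fin n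
  vertex zero = a
  vertex (suc zero) = b
  vertex (suc (suc zero)) = c
  vertex (suc (suc (suc zero))) = d
  vertex-index : ∀ x → vertex (index x) ≡ x
  vertex-index x with x ≟ a | x ≟ b | x ≟ c | x ≟ d
  ... | yes x≡a | _ | _ | _ = sym x≡a
  ... | no _ | yes x≡b | _ | _ = sym x≡b
  ... | no _ | no _ | yes x≡c | _ = sym x≡c
  ... | no _ | no _ | no _ | yes x≡d = sym x≡d
  ... | no x≢a | no x≢b | no x≢c | no x≢d = ⊥-elim (¬fifth (x , x≢a , x≢b , x≢c , x≢d))
  index-injective : ∀ {x y} → index x ≡ index y → x ≡ y
  index-injective {x} {y} e = trans (sym (vertex-index x)) (trans (cong vertex e) (vertex-index y))

module _ {n : ℕ} {i j : Fin n} (i≢j : i ≢ j) where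

  transpose-i : transpose i j i ≡ j
  transpose-i rewrite dec-true (i ≟ i) refl = refl

  transpose-j : transpose i j j ≡ i
  transpose-j rewrite dec-false (j ≟ i) (≢-sym i≢j) | dec-true (j ≟ j) refl = refl

  transpose-other : ∀ {k} → k ≢ i → k ≢ j → transpose i j k ≡ k
  transpose-other {k} k≢i k≢j rewrite dec-false (k ≟ i) k≢i | dec-false (k ≟ j) k≢j = refl

  transpose-involutive : ∀ k → transpose i j (transpose i j k) ≡ k
  transpose-involutive k = by-cases (k ≟ i) (k ≟ j)
    where
    by-cases : Dec (k ≡ i) → Dec (k ≡ j) → transpose i j (transpose i j k) ≡ k
    by-cases (yes refl) _ = trans (cong (transpose i j) transpose-i) transpose-j
    by-cases (no _) (yes refl) = trans (cong (transpose i j) transpose-j) transpose-i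
    by-cases (no k≢i) (no k≢j) =
      trans (cong (transpose i j) (transpose-other k≢i k≢j)) (transpose-other k≢i k≢j)

module FourCycle {n} (G : SimpleGraph n) (safe : Fin n → Bool) (5≤n : 5 ≤ n)
  (G-2conn : TwoVertexConnected G) (u w v z : Fin n)
  (u≢w : u ≢ w) (u≢v : u ≢ v) (u≢z : u ≢ z) (w≢v : w ≢ v) (w≢z : w ≢ z) (v≢z : v ≢ z)
  (Euw : adj G u w ≡ true) (Ewv : adj G w v ≡ true) (Evz : adj G v z ≡ true) (Ezu : adj G z u ≡ true)
  (deg-w : degree G w ≡ 2) (deg-z : degree G z ≡ 2)
  (v-safe : safe v ≡ true) (w-safe⇒z-safe : safe w ≡ true → safe z ≡ true) where

  E : EdgeRel n
  E = adj G

  E-sym : Symmetric E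
  E-sym = SimpleGraph.sym G

  E-conn-without : ∀ c → ConnectedOn E (_≢ c)
  E-conn-without c = non-cut⇒connectedOn (proj₁ (proj₂ G-2conn)) (proj₂ (proj₂ G-2conn) c)

  Inner : Pred (Fin n) 0ℓ
  Inner a = a ≢ w × a ≢ z

  inner? : ∀ a → Dec (Inner a)
  inner? a = ¬? (a ≟ w) ×-dec ¬? (a ≟ z)

  w-neighbour : ∀ {b} → E w b ≡ true → b ≡ u ⊎ b ≡ v
  w-neighbour = degree-2-neighbour G u≢v (trans (E-sym w u) Euw) Ewv deg-w

  z-neighbour : ∀ {b} → E z b ≡ true → b ≡ u ⊎ b ≡ v
  z-neighbour = degree-2-neighbour G u≢v Ezu (trans (E-sym z v) Evz) deg-z

  outer-neighbour : ∀ {a b} → ¬ Inner a → E a b ≡ true → b ≡ u ⊎ b ≡ v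
  outer-neighbour {a} ¬inner e with a ≟ w | a ≟ z
  ... | yes refl | _ = w-neighbour e
  ... | no _ | yes refl = z-neighbour e
  ... | no a≢w | no a≢z = ⊥-elim (¬inner (a≢w , a≢z))

  unsafe⇒≢v : ∀ {c} → safe c ≡ false → c ≢ v
  unsafe⇒≢v unsafe refl = false≢true (trans (sym unsafe) v-safe)

  z-unsafe⇒w-unsafe : safe z ≡ false → safe w ≡ false
  z-unsafe⇒w-unsafe z-unsafe =
    ¬-not λ w-safe → false≢true (trans (sym z-unsafe) (w-safe⇒z-safe w-safe))

  -- Along a path avoiding o′, the first edge leaving X ∪ {w, z} cannot start at w or z,
  -- whose only neighbours are o and o′; so it joins X to Y.
  escape : ∀ {X Y : Pred (Fin n) 0ℓ} {o o′ x} → (∀ a → Dec (X a)) →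
    (∀ {b} → b ≡ u ⊎ b ≡ v → b ≡ o ⊎ b ≡ o′) → X o → (∀ b → Inner b → ¬ X b → Y b) →
    Path E (_≢ o′) o x → Inner x → ¬ X x →
    ∃ λ a → ∃ λ b → X a × Y b × E a b ≡ true
  escape {X} {Y} {o} {o′} {x} X? uv⇒oo′ Xo ¬X⇒Y path inner-x ¬Xx
    with path-crossing T (λ a → X? a ⊎-dec ¬? (inner? a)) path (inj₁ Xo) ¬Tx
    where
    T : Pred (Fin n) 0ℓ
    T a = X a ⊎ ¬ Inner a
    ¬Tx : ¬ T x
    ¬Tx (inj₁ Xx) = ¬Xx Xx
    ¬Tx (inj₂ ¬inner) = ¬inner inner-x
  ... | a , b , e , _ , b≢o′ , Ta , ¬Tb = a , b , T⇒X Ta , ¬X⇒Y b inner-b (¬Tb ∘ inj₁) , e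
    where
    inner-b : Inner b
    inner-b = decidable-stable (inner? b) (¬Tb ∘ inj₂)
    T⇒X : X a ⊎ ¬ Inner a → X a
    T⇒X (inj₁ Xa) = Xa
    T⇒X (inj₂ ¬inner) with uv⇒oo′ (outer-neighbour ¬inner e)
    ... | inj₁ refl = ⊥-elim (¬Tb (inj₁ Xo))
    ... | inj₂ b≡o′ = ⊥-elim (b≢o′ b≡o′)

  module _ (F : EdgeRel n) (F-opt : OptimalFVC G safe F) (Fuw : F u w ≡ true) where

    Result : Set
    Result = Σ (EdgeRel n) λ F′ → OptimalFVC G safe F′ × F′ u w ≡ false

    F-feasible : FeasibleFVC G safe F
    F-feasible = proj₁ F-opt

    F-sym : Symmetric F
    F-sym = proj₁ F-feasible

    F⊆E : F ⊆E E
    F⊆E = proj₁ (proj₂ F-feasible)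

    F-conn : ConnectedOn F U
    F-conn = feasible⇒connectedOn G safe F-feasible

    F-conn-without : ∀ {c} → safe c ≡ false → ConnectedOn F (_≢ c)
    F-conn-without = feasible⇒connectedOn-unsafe G safe F-feasible

    F-w-neighbour : ∀ {b} → F w b ≡ true → b ≡ u ⊎ b ≡ v
    F-w-neighbour {b} e = w-neighbour (F⊆E w b e)

    F-z-neighbour : ∀ {b} → F z b ≡ true → b ≡ u ⊎ b ≡ v
    F-z-neighbour {b} e = z-neighbour (F⊆E z b e)

    exchange : ∀ {r s} → r ≢ s → F r s ≡ false → FeasibleFVC G safe (replace F u w r s) → Result
    exchange {r} {s} r≢s Frs feasible =
      replace F u w r s , (feasible , minimal) , replace-pq F u w r s
      where
      minimal : ∀ F″ → FeasibleFVC G safe F″ → edgeCount (replace F u w r s) ≤ edgeCount F″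
      minimal F″ f″ = subst (_≤ edgeCount F″) (sym (edgeCount-replace F-sym u≢w r≢s Fuw Frs))
                            (proj₂ F-opt F″ f″)

    removal-infeasible : ¬ FeasibleFVC G safe (remove F u w)
    removal-infeasible feasible = <-irrefl refl (begin-strict
      edgeCount (remove F u w)      <⟨ m<m+n _ (s≤s z≤n) ⟩
      edgeCount (remove F u w) + 1  ≡⟨ edgeCount-remove F-sym u≢w Fuw ⟩
      edgeCount F                   ≤⟨ proj₂ F-opt _ feasible ⟩
      edgeCount (remove F u w)      ∎)
      where open ≤-Reasoning

    -- The path u–z–v–w takes over the role of the edge uw, except when z is deleted.
    cycle-detour-feasible : ∀ {F′} → Symmetric F′ → F′ ⊆E E →
      (∀ {a b} → edge u w a b ≡ false → F a b ≡ true → F′ a b ≡ true) →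
      F′ u z ≡ true → F′ z v ≡ true → F′ v w ≡ true →
      (safe z ≡ false → ConnectedOn F′ (_≢ z)) → FeasibleFVC G safe F′
    cycle-detour-feasible {F′} F′-sym F′⊆E kept F′uz F′zv F′vw z-cut =
      feasible-intro G safe F′-sym F′⊆E (detour tt tt F-conn) cut
      where
      detour : ∀ {Ok : Pred (Fin n) 0ℓ} → Ok z → Ok v → ConnectedOn F Ok → ConnectedOn F′ Ok
      detour oz ov = connectedOn-detour F′-sym kept λ ou ow →
        edge⇒path F′uz ou oz ◅◅ edge⇒path F′zv oz ov ◅◅ edge⇒path F′vw ov ow
      cut : ∀ c → safe c ≡ false → ConnectedOn F′ (_≢ c)
      cut c unsafe with c ≟ z
      ... | yes refl = z-cut unsafe
      ... | no c≢z = detour (≢-sym c≢z) (≢-sym (unsafe⇒≢v unsafe)) (F-conn-without unsafe)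

    uw≁uz : edge u w u z ≡ false
    uw≁uz = edge-falseʳ u w u (≢-sym u≢z) (≢-sym w≢z)

    uw≁zv : edge u w z v ≡ false
    uw≁zv = edge-falseˡ u w v (≢-sym u≢z) (≢-sym w≢z)

    uw≁vw : edge u w v w ≡ false
    uw≁vw = edge-falseˡ u w w (≢-sym u≢v) (≢-sym w≢v)

    uw≁wv : edge u w w v ≡ false
    uw≁wv = edge-falseʳ u w w (≢-sym u≢v) (≢-sym w≢v)

    module LeafW (Fwv : F w v ≡ false) where

      F′ : EdgeRel n
      F′ = replace F u w w v

      F′-sym : Symmetric F′
      F′-sym = replace-sym F u w w v F-sym

      F′⊆E : F′ ⊆E E
      F′⊆E = replace-⊆ F u w w v E-sym Ewv F⊆E

      F′wv : F′ w v ≡ true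
      F′wv = replace-rs F u w w v uw≁wv

      leaf : ∀ {b} → F w b ≡ true → b ≡ u
      leaf e with F-w-neighbour e
      ... | inj₁ b≡u = b≡u
      ... | inj₂ refl = ⊥-elim (false≢true (trans (sym Fwv) e))

      leaf′ : ∀ {b} → F′ w b ≡ true → b ≡ v
      leaf′ {b} e with w-neighbour (F′⊆E w b e)
      ... | inj₂ b≡v = b≡v
      ... | inj₁ refl =
        ⊥-elim (false≢true (trans (sym (trans (F′-sym w u) (replace-pq F u w w v))) e))

      transfer : ∀ {Ok : Pred (Fin n) 0ℓ} → Ok w → Ok v → ConnectedOn F Ok → ConnectedOn F′ Ok
      transfer {Ok} ow ov = connectedOn-contract-leaf F-sym F′-sym u≢w leaf
        (λ e oa ob a≢w b≢w → edge⇒path (replace-keeps F u w w v (edge-false-q u w a≢w b≢w) e) oa ob)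
        reach
        where
        reach : ∀ x → Ok x → ∃ λ y → Ok y × y ≢ w × Path F′ Ok x y
        reach x ox with x ≟ w
        ... | yes refl = v , ov , ≢-sym w≢v , edge⇒path F′wv ow ov
        ... | no x≢w = x , ox , x≢w , ε

      F′-conn-without : ∀ c → safe c ≡ false → ConnectedOn F′ (_≢ c)
      F′-conn-without c unsafe with c ≟ w
      ... | yes refl = connectedOn-delete-leaf F′-sym (≢-sym w≢v) leaf′ (transfer tt tt F-conn)
      ... | no c≢w = transfer (≢-sym c≢w) (≢-sym (unsafe⇒≢v unsafe)) (F-conn-without unsafe)

      result : Result
      result = exchange w≢v Fwv
        (feasible-intro G safe F′-sym F′⊆E (transfer tt tt F-conn) F′-conn-without)

    module Transposed (Fwv : F w v ≡ true) (Fuz : F u z ≡ false) where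

      F′ : EdgeRel n
      F′ = replace F u w u z

      F′-sym : Symmetric F′
      F′-sym = replace-sym F u w u z F-sym

      σ : Fin n → Fin n
      σ = transpose w z

      σ-inv : ∀ x → σ (σ x) ≡ x
      σ-inv = transpose-involutive w≢z

      leaf : ∀ {b} → F z b ≡ true → b ≡ v
      leaf e with F-z-neighbour e
      ... | inj₁ refl = ⊥-elim (false≢true (trans (sym Fuz) (trans (F-sym u z) e)))
      ... | inj₂ b≡v = b≡v

      Fzv : F z v ≡ true
      Fzv with star-first-step (F-conn z u tt tt) (≢-sym u≢z)
      ... | b , e , _ = subst (λ t → F z t ≡ true) (leaf e) e

      from-outer : ∀ {a b} → a ≡ w ⊎ a ≡ z → F a b ≡ true → F′ (σ a) (σ b) ≡ true
      from-outer (inj₁ refl) e with F-w-neighbour e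
      ... | inj₁ refl rewrite transpose-i w≢z | transpose-other w≢z u≢w u≢z =
        replace-sr F u w u z (edge-falseˡ u w u (≢-sym u≢z) (≢-sym w≢z))
      ... | inj₂ refl rewrite transpose-i w≢z | transpose-other w≢z (≢-sym w≢v) v≢z =
        replace-keeps F u w u z uw≁zv Fzv
      from-outer (inj₂ refl) e with leaf e
      ... | refl rewrite transpose-j w≢z | transpose-other w≢z (≢-sym w≢v) v≢z =
        replace-keeps F u w u z uw≁wv Fwv

      σ-edge : ∀ {a b} → F a b ≡ true → F′ (σ a) (σ b) ≡ true
      σ-edge {a} {b} e = by-cases (a ≟ w ⊎-dec a ≟ z) (b ≟ w ⊎-dec b ≟ z)
        where
        by-cases : Dec (a ≡ w ⊎ a ≡ z) → Dec (b ≡ w ⊎ b ≡ z) → F′ (σ a) (σ b) ≡ true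
        by-cases (yes outer-a) _ = from-outer outer-a e
        by-cases (no _) (yes outer-b) =
          trans (F′-sym (σ a) (σ b)) (from-outer outer-b (trans (F-sym b a) e))
        by-cases (no inner-a) (no inner-b) =
          subst₂ (λ x y → F′ x y ≡ true)
            (sym (transpose-other w≢z (inner-a ∘ inj₁) (inner-a ∘ inj₂)))
            (sym (transpose-other w≢z (inner-b ∘ inj₁) (inner-b ∘ inj₂)))
            (replace-keeps F u w u z (edge-false-q u w (inner-a ∘ inj₁) (inner-b ∘ inj₁)) e)

      F-conn-without-σ : ∀ c → safe c ≡ false → ConnectedOn F (_≢ σ c)
      F-conn-without-σ c unsafe = by-cases (c ≟ w) (c ≟ z)
        where
        by-cases : Dec (c ≡ w) → Dec (c ≡ z) → ConnectedOn F (_≢ σ c)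
        by-cases (yes refl) _ = subst (λ t → ConnectedOn F (_≢ t)) (sym (transpose-i w≢z))
          (connectedOn-delete-leaf F-sym v≢z leaf F-conn)
        by-cases (no _) (yes refl) = subst (λ t → ConnectedOn F (_≢ t)) (sym (transpose-j w≢z))
          (F-conn-without (z-unsafe⇒w-unsafe unsafe))
        by-cases (no c≢w) (no c≢z) = subst (λ t → ConnectedOn F (_≢ t))
          (sym (transpose-other w≢z c≢w c≢z)) (F-conn-without unsafe)

      F′-conn-without : ∀ c → safe c ≡ false → ConnectedOn F′ (_≢ c)
      F′-conn-without c unsafe = connectedOn-involution {σ = σ} σ-inv F′-sym σ-edge
        (λ {a} a≢σc σa≡c → a≢σc (trans (sym (σ-inv a)) (cong σ σa≡c)))
        (λ {x} x≢c σx≡σc → x≢c (trans (sym (σ-inv x)) (trans (cong σ σx≡σc) (σ-inv c))))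
        (F-conn-without-σ c unsafe)

      result : Result
      result = exchange u≢z Fuz
        (feasible-intro G safe F′-sym (replace-⊆ F u w u z E-sym (trans (E-sym u z) Ezu) F⊆E)
          (connectedOn-involution {σ = σ} σ-inv F′-sym σ-edge (λ _ → tt) (λ _ → tt) F-conn)
          F′-conn-without)

    module LeafZ (Fwv : F w v ≡ true) (Fuz : F u z ≡ true) (Fvz : F v z ≡ false) where

      F′ : EdgeRel n
      F′ = replace F u w v z

      F′-sym : Symmetric F′
      F′-sym = replace-sym F u w v z F-sym

      kept : ∀ {a b} → edge u w a b ≡ false → F a b ≡ true → F′ a b ≡ true
      kept = replace-keeps F u w v z

      F′vw : F′ v w ≡ true
      F′vw = kept uw≁vw (trans (F-sym v w) Fwv)

      leaf : ∀ {b} → F z b ≡ true → b ≡ u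
      leaf e with F-z-neighbour e
      ... | inj₁ b≡u = b≡u
      ... | inj₂ refl = ⊥-elim (false≢true (trans (sym Fvz) (trans (F-sym v z) e)))

      F′-conn-without-z : safe z ≡ false → ConnectedOn F′ (_≢ z)
      F′-conn-without-z z-unsafe = connectedOn-contract-leaf F-sym F′-sym u≢z leaf
        (λ e a≢w b≢w a≢z b≢z → edge⇒path (kept (edge-false-q u w a≢w b≢w) e) a≢z b≢z)
        reach (F-conn-without (z-unsafe⇒w-unsafe z-unsafe))
        where
        reach : ∀ x → x ≢ z → ∃ λ y → y ≢ w × y ≢ z × Path F′ (_≢ z) x y
        reach x x≢z with x ≟ w
        ... | yes refl = v , ≢-sym w≢v , v≢z , path-reverse F′-sym (edge⇒path F′vw v≢z w≢z)
        ... | no x≢w = x , x≢w , x≢z , ε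

      result : Result
      result = exchange v≢z Fvz
        (cycle-detour-feasible F′-sym (replace-⊆ F u w v z E-sym Evz F⊆E) kept
          (kept uw≁uz Fuz) (replace-sr F u w v z uw≁zv) F′vw F′-conn-without-z)

    module CycleInF (Fwv : F w v ≡ true) (Fuz : F u z ≡ true) (Fzv : F z v ≡ true) where

      F-vw : F v w ≡ true
      F-vw = trans (F-sym v w) Fwv

      inner-lift : ∀ {F′} → (∀ {a b} → edge u w a b ≡ false → F a b ≡ true → F′ a b ≡ true) →
        ∀ {x y} → Path F Inner x y → Path F′ (_≢ z) x y
      inner-lift kept = path-mono λ e (a≢w , a≢z) (b≢w , b≢z) →
        kept (edge-false-q u w a≢w b≢w) e , a≢z , b≢z

      removal-feasible : (safe z ≡ false → ConnectedOn (remove F u w) (_≢ z)) →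
        FeasibleFVC G safe (remove F u w)
      removal-feasible = cycle-detour-feasible (remove-sym F u w F-sym)
        (λ a b e → F⊆E a b (remove-⊆ F u w a b e)) (remove-keeps F u w)
        (remove-keeps F u w uw≁uz Fuz) (remove-keeps F u w uw≁zv Fzv)
        (remove-keeps F u w uw≁vw F-vw)

      module Bridge (z-unsafe : safe z ≡ false) (¬inner-path : ¬ Path F Inner u v) where

        A : Pred (Fin n) 0ℓ
        A = Path F Inner u

        B : Pred (Fin n) 0ℓ
        B = Path F Inner v

        disjoint : ∀ {x} → A x → B x → ⊥
        disjoint ax bx = ¬inner-path (ax ◅◅ path-reverse F-sym bx)

        inner-split : ∀ x → Inner x → A x ⊎ B x
        inner-split x = along (F-conn u x tt tt) (λ _ → inj₁ ε)
          where
          along : ∀ {c y} → Path F U c y → (Inner c → A c ⊎ B c) → Inner y → A y ⊎ B y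
          along ε split-c = split-c
          along {c} (_◅_ {j = d} (e , _) p) split-c = along p split-d
            where
            split-d : Inner d → A d ⊎ B d
            split-d inner-d with inner? c
            ... | yes inner-c = Sum.map (_◅◅ edge⇒path e inner-c inner-d)
                                        (_◅◅ edge⇒path e inner-c inner-d) (split-c inner-c)
            ... | no outer-c with outer-neighbour outer-c (F⊆E c d e)
            ...   | inj₁ refl = inj₁ ε
            ...   | inj₂ refl = inj₂ ε

        bridge : ∃ λ a → ∃ λ b → A a × B b × E a b ≡ true
        bridge with fifth-vertex 5≤n u v w z
        ... | x , x≢u , x≢v , x≢w , x≢z with inner-split x (x≢w , x≢z)
        ...   | inj₂ Bx = escape (path? F inner? u) (λ b → b) ε ¬A⇒B
                            (E-conn-without v u x u≢v x≢v) (x≢w , x≢z) (λ Ax → disjoint Ax Bx)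
          where
          ¬A⇒B : ∀ b → Inner b → ¬ A b → B b
          ¬A⇒B b inner-b ¬Ab = [ ⊥-elim ∘ ¬Ab , (λ Bb → Bb) ]′ (inner-split b inner-b)
        ...   | inj₁ Ax with escape (path? F inner? v) Sum.swap ε ¬B⇒A
                    (E-conn-without u v x (≢-sym u≢v) x≢u) (x≢w , x≢z) (λ Bx → disjoint Ax Bx)
          where
          ¬B⇒A : ∀ b → Inner b → ¬ B b → A b
          ¬B⇒A b inner-b ¬Bb = [ (λ Ab → Ab) , ⊥-elim ∘ ¬Bb ]′ (inner-split b inner-b)
        ...     | a , b , Ba , Ab , Eab = b , a , Ab , Ba , trans (E-sym b a) Eab

        a b : Fin n
        a = proj₁ bridge
        b = proj₁ (proj₂ bridge)

        Aa : A a
        Aa = proj₁ (proj₂ (proj₂ bridge))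

        Bb : B b
        Bb = proj₁ (proj₂ (proj₂ (proj₂ bridge)))

        Eab : E a b ≡ true
        Eab = proj₂ (proj₂ (proj₂ (proj₂ bridge)))

        inner-a : Inner a
        inner-a = path-okʳ Aa (u≢w , u≢z)

        inner-b : Inner b
        inner-b = path-okʳ Bb (≢-sym w≢v , v≢z)

        Fab : F a b ≡ false
        Fab = ¬-not λ e → disjoint (Aa ◅◅ edge⇒path e inner-a inner-b) Bb

        a≢b : a ≢ b
        a≢b a≡b = disjoint (subst A a≡b Aa) Bb

        F′ : EdgeRel n
        F′ = replace F u w a b

        F′-sym : Symmetric F′
        F′-sym = replace-sym F u w a b F-sym

        kept : ∀ {x y} → edge u w x y ≡ false → F x y ≡ true → F′ x y ≡ true
        kept = replace-keeps F u w a b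

        F′ab : F′ a b ≡ true
        F′ab = replace-rs F u w a b (edge-false-q u w (proj₁ inner-a) (proj₁ inner-b))

        v⇝u : Path F′ (_≢ z) v u
        v⇝u = inner-lift kept Bb
          ◅◅ path-reverse F′-sym (edge⇒path F′ab (proj₂ inner-a) (proj₂ inner-b))
          ◅◅ path-reverse F′-sym (inner-lift kept Aa)

        ⇝u : ∀ x → x ≢ z → Path F′ (_≢ z) x u
        ⇝u x x≢z with x ≟ w
        ... | yes refl = edge⇒path (kept uw≁wv Fwv) w≢z v≢z ◅◅ v⇝u
        ... | no x≢w with inner-split x (x≢w , x≢z)
        ...   | inj₁ Ax = path-reverse F′-sym (inner-lift kept Ax)
        ...   | inj₂ Bx = path-reverse F′-sym (inner-lift kept Bx) ◅◅ v⇝u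

        result : Result
        result = exchange a≢b Fab
          (cycle-detour-feasible F′-sym (replace-⊆ F u w a b E-sym Eab F⊆E)
            kept (kept uw≁uz Fuz) (kept uw≁zv Fzv) (kept uw≁vw F-vw)
            λ _ x y x≢z y≢z → ⇝u x x≢z ◅◅ path-reverse F′-sym (⇝u y y≢z))

      result : Result
      result with safe z in z-safety | path? F inner? u v
      ... | true | _ = ⊥-elim (removal-infeasible (removal-feasible λ z-unsafe →
                         ⊥-elim (false≢true (trans (sym z-unsafe) z-safety))))
      ... | false | yes inner-path = ⊥-elim (removal-infeasible (removal-feasible λ z-unsafe →
            connectedOn-detour (remove-sym F u w F-sym) (remove-keeps F u w)
              (λ _ ow → inner-lift (remove-keeps F u w) inner-path
                        ◅◅ edge⇒path (remove-keeps F u w uw≁vw F-vw) v≢z ow)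
              (F-conn-without z-unsafe)))
      ... | false | no ¬inner-path = Bridge.result z-safety ¬inner-path

    optimal-without-uw : Result
    optimal-without-uw with F w v in Fwv | F u z in Fuz | F v z in Fvz
    ... | false | _ | _ = LeafW.result Fwv
    ... | true | false | _ = Transposed.result Fwv Fuz
    ... | true | true | false = LeafZ.result Fwv Fuz Fvz
    ... | true | true | true = CycleInF.result Fwv Fuz (trans (F-sym z v) Fvz)

mainTheorem3 : (n : ℕ) → (G : SimpleGraph n) → (safe : Fin n → Bool) →
    5 ≤ n → TwoVertexConnected G →
    (u w v z : Fin n) →
    u ≢ w → u ≢ v → u ≢ z → w ≢ v → w ≢ z → v ≢ z →
    adj G u w ≡ true → adj G w v ≡ true → adj G v z ≡ true → adj G z u ≡ true →
    degree G w ≡ 2 → degree G z ≡ 2 →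
    safe v ≡ true →
    (safe w ≡ true → safe z ≡ true) →
    Σ (EdgeRel n) (λ F → OptimalFVC G safe F × F u w ≡ false)
mainTheorem3 n G safe 5≤n G-2conn u w v z u≢w u≢v u≢z w≢v w≢z v≢z Euw Ewv Evz Ezu deg-w deg-z
             v-safe w-safe⇒z-safe
  with optimal-exists G safe (twoConnected⇒feasible G safe G-2conn)
... | F , F-opt with F u w in Fuw
...   | false = F , F-opt , Fuw
...   | true = FourCycle.optimal-without-uw G safe 5≤n G-2conn u w v z u≢w u≢v u≢z w≢v w≢z v≢z
                 Euw Ewv Evz Ezu deg-w deg-z v-safe w-safe⇒z-safe F F-opt Fuw
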